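{- Let $S$ be a finite commutative semigroup with $\exp(S)=n$, and let $K$ be a splitting field of $S$. For any $a\in S$ with ${\rm St}(H_a)\ne\emptyset$, we have $\exp(\Gamma(H_a))\mid n$, and $K$ is also a splitting field of the group $\Gamma(H_a)$.
   Context: $S$ is written additively. The period of $x\in S$ is the least $m>0$ with $(k+m)x=kx$, where $k$ is the index of $x$ (least $k>0$ with $kx=tx$ for some $t\ne k$); $\exp(S)$ is the lcm of all periods (for a finite abelian group this is the usual exponent). A field $K$ is a splitting field of $S$ (resp. of a finite abelian group $G$) if $\#\{\zeta\in K:\zeta^N=1\}=N$ where $N=\exp(S)$ (resp. $N=\exp(G)$). $(a)=\{a\}\cup(a+S)$; $a\,\mathcal H\,b$ iff $(a)=(b)$; $H_a$ is the class of $a$; ${\rm St}(H_a)=\{c:c+H_a\subseteq H_a\}$; for $c\in{\rm St}(H_a)$, $\gamma_c:H_a\to H_a$, $x\mapsto c+x$; $\Gamma(H_a)=\{\gamma_c:c\in{\rm St}(H_a)\}$ with $\gamma_c+\gamma_d=\gamma_{c+d}$ is an abelian group (the Schützenberger group). -}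

module Defs where

open import Level using (Level; _⊔_)
open import Data.Nat using (ℕ; zero; suc; _+_; _≤_; _<_)
open import Data.Nat.Divisibility using (_∣_)
open import Data.Fin using (Fin)
open import Data.Product using (Σ; ∃; _×_; _,_)
open import Data.Sum using (_⊎_)
open import Data.List using (List; length)
open import Data.List.Relation.Unary.All using (All)
open import Data.List.Relation.Unary.Any using (Any)
open import Data.List.Relation.Unary.AllPairs using (AllPairs)
open import Relation.Binary.PropositionalEquality using (_≡_; _≢_)
open import Relation.Nullary using (¬_)
open import Algebra.Bundles using (CommutativeRing)

record FinCommSemigroup : Set where
  field
    size  : ℕ
    _⊕_   : Fin size → Fin size → Fin size
    assoc : ∀ x y z → (x ⊕ y) ⊕ z ≡ x ⊕ (y ⊕ z)
    comm  : ∀ x y → x ⊕ y ≡ y ⊕ x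

module _ (S : FinCommSemigroup) where
  open FinCommSemigroup S

  El : Set
  El = Fin size

  -- mul k x = k x  for k ≥ 1  (mul 0 x = x is a junk value, never used:
  -- every use below is guarded by 1 ≤ k)
  mul : ℕ → El → El
  mul zero x          = x
  mul (suc zero) x    = x
  mul (suc (suc k)) x = x ⊕ mul (suc k) x

  Repeats : El → ℕ → Set
  Repeats x k = ∃ λ t → 1 ≤ t × t ≢ k × mul k x ≡ mul t x

  IsIndex : El → ℕ → Set
  IsIndex x k = 1 ≤ k × Repeats x k × (∀ k' → 1 ≤ k' → k' < k → ¬ Repeats x k')

  IsPeriod : El → ℕ → Set
  IsPeriod x m = ∃ λ k → IsIndex x k × 1 ≤ m × mul (k + m) x ≡ mul k x
                   × (∀ m' → 1 ≤ m' → m' < m → ¬ (mul (k + m') x ≡ mul k x))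

  IsExp : ℕ → Set
  IsExp n = (∀ x m → IsPeriod x m → m ∣ n)
          × (∀ n' → (∀ x m → IsPeriod x m → m ∣ n') → n ∣ n')

  _∈⟨_⟩ : El → El → Set
  b ∈⟨ a ⟩ = b ≡ a ⊎ ∃ λ s → b ≡ a ⊕ s

  _𝓗_ : El → El → Set
  a 𝓗 b = ∀ c → (c ∈⟨ a ⟩ → c ∈⟨ b ⟩) × (c ∈⟨ b ⟩ → c ∈⟨ a ⟩)

  _∈H_ : El → El → Set
  x ∈H a = a 𝓗 x

  _∈St_ : El → El → Set
  c ∈St a = ∀ x → x ∈H a → (c ⊕ x) ∈H a

  -- γ_c = γ_d in Γ(H_a) (equality of maps H_a → H_a)
  γ≐ : El → El → El → Set
  γ≐ a c d = ∀ x → x ∈H a → c ⊕ x ≡ d ⊕ x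

  IsNeutralΓ : El → El → Set
  IsNeutralΓ a u = u ∈St a × (∀ d → d ∈St a → γ≐ a (u ⊕ d) d)

  -- γ_c ^ N = N γ_c = γ_{N c}  is the neutral element of Γ(H_a)
  PowNeutral : El → ℕ → El → Set
  PowNeutral a N c = IsNeutralΓ a (mul N c)

  IsExpΓ : El → ℕ → Set
  IsExpΓ a N = 1 ≤ N × (∀ c → c ∈St a → PowNeutral a N c)
             × (∀ N' → 1 ≤ N' → N' < N → ¬ (∀ c → c ∈St a → PowNeutral a N' c))

record Field (c ℓ : Level) : Set (Level.suc (c ⊔ ℓ)) where
  field
    commutativeRing : CommutativeRing c ℓ
  open CommutativeRing commutativeRing public
  field
    1≉0     : ¬ (1# ≈ 0#)
    inverse : ∀ x → ¬ (x ≈ 0#) → ∃ λ y → x * y ≈ 1#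

module _ {c ℓ : Level} (K : Field c ℓ) where
  open Field K

  pow : Carrier → ℕ → Carrier
  pow x zero    = 1#
  pow x (suc k) = x * pow x k

  -- #{ζ ∈ K : ζ^N = 1} = N : there is a list of exactly N pairwise
  -- distinct N-th roots of unity containing every N-th root of unity.
  RootsOfUnityCount : ℕ → Set (c ⊔ ℓ)
  RootsOfUnityCount N =
    Σ (List Carrier) λ zs →
        length zs ≡ N
      × All (λ ζ → pow ζ N ≈ 1#) zs
      × AllPairs (λ ζ ξ → ¬ (ζ ≈ ξ)) zs
      × (∀ ζ → pow ζ N ≈ 1# → Any (λ ξ → ζ ≈ ξ) zs)

  IsSplittingFieldFor : ℕ → Set (c ⊔ ℓ)
  IsSplittingFieldFor N = RootsOfUnityCount N

-- Write γ c for translation by c.  If the period of c divides n then γ c ^ n fixes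
-- k c, where k is the index of c, and therefore fixes every element of the ideal (k c).
-- For c ∈ St(H_a), each x ∈ H_a generates the same ideal as c + x, so x lies in (k c)
-- and γ c ^ n is the identity on H_a.  The exponents N for which γ c ^ N is the identity
-- on H_a for every c ∈ St(H_a) are closed under subtraction, so the least positive one
-- divides n.  Because γ c ^ n = id makes γ c surjective on H_a, γ c ^ N = id is the same
-- as γ_{N c} being the neutral element of Γ(H_a), so that least N is exp Γ(H_a).
--
-- For the field, write n = t N.  A polynomial function of degree d that takes one value
-- at d + 1 distinct points is constant.  So x ^ N = 1 has at most N roots, and
-- x ^ t = ξ has at most t roots when ξ ≠ 0.  The map ζ ↦ ζ ^ t sends the n distinct
-- n-th roots of unity to N-th roots of unity, so there are at least n / t = N of them.

module Submission where

open import Defs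
open import Level using (Level; _⊔_; 0ℓ)
open import Data.Nat as ℕ using (ℕ; zero; suc; _≤_; _<_; z≤n; s≤s; _<?_; _≤?_; NonZero)
import Data.Nat.Properties as ℕₚ
open import Data.Nat.Properties using (≰⇒>; +-mono-≤; +-suc; ≤-antisym; *-cancelʳ-≤; m*n≢0⇒m≢0; m*n≢0⇒n≢0)
open import Data.Nat.Induction using (<-wellFounded)
open import Data.Nat.DivMod using (_%_; _/_; m≡m%n+[m/n]*n; m%n<n)
open import Data.Nat.Divisibility using (_∣_; divides; _∣0; ∣-refl; ∣m∸n∣n⇒∣m)
open import Data.Fin using (Fin; toℕ) renaming (_≟_ to _≟ᶠ_)
open import Data.Fin.Properties using (pigeonhole; all?; any?)
open import Data.Product using (Σ; ∃; _×_; _,_; proj₁; proj₂)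
open import Data.Sum using (inj₁; inj₂)
open import Data.Empty using (⊥-elim)
open import Data.List using (List; []; _∷_; length; filter; map)
open import Data.List.Properties using (length-map)
open import Data.List.Relation.Unary.All as All using (All; []; _∷_)
import Data.List.Relation.Unary.All.Properties as All
open import Data.List.Relation.Unary.Any as Any using (Any; here; there)
import Data.List.Relation.Unary.Any.Properties as Any
open import Data.List.Relation.Unary.AllPairs as AllPairs using (AllPairs; []; _∷_)
import Data.List.Relation.Unary.AllPairs.Properties as AllPairs
open import Function using (_∘_)
open import Induction.WellFounded using (Acc; acc)
open import Relation.Binary.PropositionalEquality as ≡ using (_≡_; _≢_)
open import Relation.Binary.Bundles using (Setoid)
open import Relation.Binary.Definitions using (Decidable; tri<; tri≈; tri>)
open import Relation.Nullary using (¬_; Dec; yes; no)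
open import Relation.Nullary.Decidable using (_×-dec_; _⊎-dec_; _→-dec_)
import Relation.Unary as U
open import Relation.Unary using (_∈_)
open import Relation.Unary.Properties using (∁?)

module _ {p} {P : ℕ → Set p} (P? : U.Decidable P) where

  least-witness : ∀ {n} → P n → ∃ λ k → P k × (∀ {j} → j < k → ¬ P j)
  least-witness = go (<-wellFounded _)
    where
    go : ∀ {n} → Acc _<_ n → P n → ∃ λ k → P k × (∀ {j} → j < k → ¬ P j)
    go {n} (acc smaller) Pn with ℕₚ.anyUpTo? P? n
    ... | yes (j , j<n , Pj) = go (smaller j<n) Pj
    ... | no  none           = n , Pn , λ j<n Pj → none (_ , j<n , Pj)

module _ {p} {P : ℕ → Set p} (P-∸ : ∀ {i j} → i ≤ j → P i → P j → P (j ℕ.∸ i))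
         {N} (1≤N : 1 ≤ N) (PN : P N) (none-below : ∀ {j} → 1 ≤ j → j < N → ¬ P j) where

  least-positive-∣ : ∀ {n} → P n → N ∣ n
  least-positive-∣ = go (<-wellFounded _)
    where
    go : ∀ {n} → Acc _<_ n → P n → N ∣ n
    go {zero}  _              _  = N ∣0
    go {suc n} (acc smaller) Pn with suc n <? N
    ... | yes n<N = ⊥-elim (none-below (s≤s z≤n) n<N Pn)
    ... | no  n≮N = ∣m∸n∣n⇒∣m N N≤n (go (smaller (ℕₚ.∸-monoʳ-< 1≤N N≤n)) (P-∸ N≤n PN Pn)) ∣-refl
      where
      N≤n : N ≤ suc n
      N≤n = ℕₚ.≮⇒≥ n≮N

module _ {a} {A : Set a} where
  open import Function.Endo.Propositional A using (_^_; ^-homo)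
  open import Data.Nat using (_+_; _*_)
  open ≡ using (refl; trans; cong; cong-app)

  ^-+ : ∀ f i j x → (f ^ (i + j)) x ≡ (f ^ i) ((f ^ j) x)
  ^-+ f i j x = cong-app (^-homo f i j) x

  ^-*-fixes : ∀ f m {x} → (f ^ m) x ≡ x → ∀ q → (f ^ (q * m)) x ≡ x
  ^-*-fixes f m fᵐx≡x zero    = refl
  ^-*-fixes f m {x} fᵐx≡x (suc q) =
    trans (^-+ f m (q * m) x) (trans (cong (f ^ m) (^-*-fixes f m fᵐx≡x q)) fᵐx≡x)

length-filter+filter-∁ : ∀ {a p} {A : Set a} {P : A → Set p} (P? : U.Decidable P) xs →
                         length (filter P? xs) ℕ.+ length (filter (∁? P?) xs) ≡ length xs
length-filter+filter-∁ P? [] = ≡.refl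
length-filter+filter-∁ P? (x ∷ xs) with P? x
... | yes _ = ≡.cong suc (length-filter+filter-∁ P? xs)
... | no  _ = ≡.trans (+-suc _ _) (≡.cong suc (length-filter+filter-∁ P? xs))

module _ {a b r d} {A : Set a} {B : Set b} {R : A → B → Set r} (R? : Decidable R)
         {D : A → A → Set d} where

  Fibre? : ∀ y → U.Decidable (λ x → R x y)
  Fibre? y x = R? x y

  length≤length*fibre : ∀ t F {xs} → AllPairs D xs → All (λ x → Any (R x) F) xs →
    All (λ y → ∀ {zs} → AllPairs D zs → All (λ x → R x y) zs → length zs ≤ t) F →
    length xs ≤ length F ℕ.* t
  length≤length*fibre t [] {[]} _ _ _ = z≤n
  length≤length*fibre t [] {_ ∷ _} _ (() ∷ _) _
  length≤length*fibre t (y ∷ F) {xs} distinct covered (fibre≤t ∷ fibres≤t) = begin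
    length xs                                       ≡⟨ ≡.sym (length-filter+filter-∁ (Fibre? y) xs) ⟩
    length (filter (Fibre? y) xs) ℕ.+ length others  ≤⟨ +-mono-≤ in-fibre≤t others≤ ⟩
    t ℕ.+ length F ℕ.* t                             ∎
    where
    open ℕₚ.≤-Reasoning
    others : List A
    others = filter (∁? (Fibre? y)) xs
    in-fibre≤t : length (filter (Fibre? y) xs) ≤ t
    in-fibre≤t = fibre≤t (AllPairs.filter⁺ (Fibre? y) distinct) (All.all-filter (Fibre? y) xs)
    others-covered : All (λ x → Any (R x) F) others
    others-covered = All.zipWith (λ { (¬Rxy , here Rxy) → ⊥-elim (¬Rxy Rxy) ; (_ , there p) → p })
                       (All.all-filter (∁? (Fibre? y)) xs , All.filter⁺ (∁? (Fibre? y)) covered)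
    others≤ : length others ≤ length F ℕ.* t
    others≤ = length≤length*fibre t F (AllPairs.filter⁺ (∁? (Fibre? y)) distinct) others-covered fibres≤t

module _ {c ℓ} (S : Setoid c ℓ) where
  open Setoid S

  All≉⇒≉ : ∀ {z x zs} → All (z ≉_) zs → Any (x ≈_) zs → ¬ z ≈ x
  All≉⇒≉ z≉ x∈ z≈x = All.lookupWith (λ z≉w x≈w → z≉w (trans z≈x x≈w)) z≉ x∈

  ≈-dec-within-distinct : ∀ {zs x y} → AllPairs _≉_ zs →
                          Any (x ≈_) zs → Any (y ≈_) zs → Dec (x ≈ y)
  ≈-dec-within-distinct (_ ∷ _)    (here x≈z) (here y≈z) = yes (trans x≈z (sym y≈z))
  ≈-dec-within-distinct (z≉ ∷ _)   (here x≈z) (there y∈) = no λ x≈y → All≉⇒≉ z≉ y∈ (trans (sym x≈z) x≈y)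
  ≈-dec-within-distinct (z≉ ∷ _)   (there x∈) (here y≈z) = no λ x≈y → All≉⇒≉ z≉ x∈ (trans (sym y≈z) (sym x≈y))
  ≈-dec-within-distinct (_ ∷ zs≉) (there x∈) (there y∈) = ≈-dec-within-distinct zs≉ x∈ y∈

module Orbit {m} (f : Fin m → Fin m) (x : Fin m) where
  open import Function.Endo.Propositional (Fin m) using (_^_)
  open import Data.Nat using (_+_; _*_; _∸_)
  open ≡ using (refl; sym; trans; cong; subst; module ≡-Reasoning)

  orbit : ℕ → Fin m
  orbit j = (f ^ j) x

  RepeatsEarlier : ℕ → Set
  RepeatsEarlier j = ∃ λ i → i < j × orbit i ≡ orbit j

  RepeatsEarlier? : U.Decidable RepeatsEarlier
  RepeatsEarlier? j = ℕₚ.anyUpTo? (λ i → orbit i ≟ᶠ orbit j) j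

  some-repeat : ∃ RepeatsEarlier
  some-repeat with i , j , i<j , eq ← pigeonhole (ℕₚ.n<1+n m) (orbit ∘ toℕ) = toℕ j , toℕ i , i<j , eq

  record FirstRepeat : Set where
    field
      start end   : ℕ
      start<end   : start < end
      repeat      : orbit start ≡ orbit end
      injective   : ∀ {i j} → i < end → j < end → orbit i ≡ orbit j → i ≡ j

  first-repeat : FirstRepeat
  first-repeat with least-witness RepeatsEarlier? (proj₂ some-repeat)
  ... | J , (I , I<J , eq) , none = record
    { start = I ; end = J ; start<end = I<J ; repeat = eq ; injective = injective }
    where
    injective : ∀ {i j} → i < J → j < J → orbit i ≡ orbit j → i ≡ j
    injective {i} {j} i<J j<J eq with ℕₚ.<-cmp i j
    ... | tri< i<j _ _ = ⊥-elim (none j<J (i , i<j , eq))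
    ... | tri≈ _ i≡j _ = i≡j
    ... | tri> _ _ j<i = ⊥-elim (none i<J (j , j<i , sym eq))

  open FirstRepeat first-repeat public

  period : ℕ
  period = end ∸ start

  period+start≡end : period + start ≡ end
  period+start≡end = ℕₚ.m∸n+n≡m (ℕₚ.<⇒≤ start<end)

  instance
    period≢0 : NonZero period
    period≢0 = ℕ.>-nonZero (ℕₚ.m<n⇒0<n∸m start<end)

  period-fixes : (f ^ period) (orbit start) ≡ orbit start
  period-fixes = trans (sym (^-+ f period start x)) (trans (cong orbit period+start≡end) (sym repeat))

  orbit-reduce : ∀ u → orbit (u + start) ≡ orbit (u % period + start)
  orbit-reduce u = begin
    orbit (u + start)                           ≡⟨ cong (λ v → orbit (v + start)) (m≡m%n+[m/n]*n u period) ⟩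
    orbit ((r + q * period) + start)            ≡⟨ cong orbit (ℕₚ.+-assoc r (q * period) start) ⟩
    orbit (r + (q * period + start))            ≡⟨ ^-+ f r (q * period + start) x ⟩
    (f ^ r) (orbit (q * period + start))        ≡⟨ cong (f ^ r) (^-+ f (q * period) start x) ⟩
    (f ^ r) ((f ^ (q * period)) (orbit start))  ≡⟨ cong (f ^ r) (^-*-fixes f period period-fixes q) ⟩
    (f ^ r) (orbit start)                       ≡⟨ sym (^-+ f r start x) ⟩
    orbit (r + start)                           ∎
    where
    open ≡-Reasoning
    r q : ℕ
    r = u % period
    q = u / period

  tail-unique : ∀ {i t} → i < start → orbit i ≡ orbit t → i ≡ t
  tail-unique {i} {t} i<start eq with t <? start
  ... | yes t<start = injective (ℕₚ.<-trans i<start start<end) (ℕₚ.<-trans t<start start<end) eq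
  ... | no  t≮start = ⊥-elim (ℕₚ.<⇒≱ i<start (subst (start ≤_) (sym i≡r) (ℕₚ.m≤n+m start (u % period))))
    where
    u : ℕ
    u = t ∸ start
    r<end : u % period + start < end
    r<end = subst (u % period + start <_) period+start≡end (ℕₚ.+-monoˡ-< start (m%n<n u period))
    i≡r : i ≡ u % period + start
    i≡r = injective (ℕₚ.<-trans i<start start<end) r<end
      (trans eq (trans (cong orbit (sym (ℕₚ.m∸n+n≡m (ℕₚ.≮⇒≥ t≮start)))) (orbit-reduce u)))

module Translations (S : FinCommSemigroup) where
  open FinCommSemigroup S
  open import Function.Endo.Propositional (El S) using (_^_)
  open import Data.Nat using (_+_; _*_; _∸_)
  open ≡ using (refl; sym; trans; cong; subst; module ≡-Reasoning)

  γ : El S → El S → El S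
  γ c = c ⊕_

  γ^-⊕ : ∀ c j u w → (γ c ^ j) (u ⊕ w) ≡ (γ c ^ j) u ⊕ w
  γ^-⊕ c zero    u w = refl
  γ^-⊕ c (suc j) u w = trans (cong (c ⊕_) (γ^-⊕ c j u w)) (sym (assoc c _ w))

  mul≡γ^ : ∀ c j → mul S (suc j) c ≡ (γ c ^ j) c
  mul≡γ^ c zero    = refl
  mul≡γ^ c (suc j) = cong (c ⊕_) (mul≡γ^ c j)

  mul-⊕≡γ^ : ∀ c j x → mul S (suc j) c ⊕ x ≡ (γ c ^ suc j) x
  mul-⊕≡γ^ c zero    x = refl
  mul-⊕≡γ^ c (suc j) x = trans (assoc c _ x) (cong (c ⊕_) (mul-⊕≡γ^ c j x))

  -- mul S (suc j) c is the j-th point of the orbit of c under γ c, so the index of c is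
  -- one more than the length of the tail, and its period is the length of the cycle.
  period-exists : ∀ c → ∃ λ m → IsPeriod S c m
  period-exists c = period , suc start , index , ℕₚ.m<n⇒0<n∸m start<end , cycle , cycle-minimal
    where
    open Orbit (γ c) c
    index : IsIndex S c (suc start)
    index = s≤s z≤n , (suc end , s≤s z≤n , start≢end , start-repeats) , no-earlier-repeat
      where
      start≢end : suc end ≢ suc start
      start≢end e = ℕₚ.<⇒≢ start<end (ℕₚ.suc-injective (sym e))
      start-repeats : mul S (suc start) c ≡ mul S (suc end) c
      start-repeats = trans (mul≡γ^ c start) (trans repeat (sym (mul≡γ^ c end)))
      no-earlier-repeat : ∀ k → 1 ≤ k → k < suc start → ¬ Repeats S c k
      no-earlier-repeat (suc i) _ (s≤s i<start) (suc t , _ , t≢i , eq) =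
        t≢i (cong suc (sym (tail-unique i<start (trans (sym (mul≡γ^ c i)) (trans eq (mul≡γ^ c t))))))
    start+period≡end : start + period ≡ end
    start+period≡end = trans (ℕₚ.+-comm start period) period+start≡end
    cycle : mul S (suc start + period) c ≡ mul S (suc start) c
    cycle = trans (mul≡γ^ c (start + period))
      (trans (cong orbit start+period≡end) (trans (sym repeat) (sym (mul≡γ^ c start))))
    cycle-minimal : ∀ d → 1 ≤ d → d < period → ¬ (mul S (suc start + d) c ≡ mul S (suc start) c)
    cycle-minimal d 1≤d d<period eq = ℕₚ.<⇒≢ (ℕₚ.m<m+n start 1≤d) (injective start<end start+d<end
      (trans (sym (mul≡γ^ c start)) (trans (sym eq) (mul≡γ^ c (start + d)))))
      where
      start+d<end : start + d < end
      start+d<end = subst (start + d <_) start+period≡end (ℕₚ.+-monoʳ-< start d<period)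

  period-fixes-multiple : ∀ {c m} → IsPeriod S c m → ∃ λ i → (γ c ^ m) (mul S (suc i) c) ≡ mul S (suc i) c
  period-fixes-multiple (zero , (() , _) , _)
  period-fixes-multiple {c} {m} (suc i , _ , _ , cycle , _) = i , (begin
    (γ c ^ m) (mul S (suc i) c)  ≡⟨ cong (γ c ^ m) (mul≡γ^ c i) ⟩
    (γ c ^ m) ((γ c ^ i) c)      ≡⟨ sym (^-+ (γ c) m i c) ⟩
    (γ c ^ (m + i)) c            ≡⟨ cong (λ k → (γ c ^ k) c) (ℕₚ.+-comm m i) ⟩
    (γ c ^ (i + m)) c            ≡⟨ sym (mul≡γ^ c (i + m)) ⟩
    mul S (suc i + m) c          ≡⟨ cycle ⟩
    mul S (suc i) c              ∎)
    where open ≡-Reasoning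

  exp-fixes-multiple : ∀ {n} → IsExp S n → ∀ c → ∃ λ i → (γ c ^ n) (mul S (suc i) c) ≡ mul S (suc i) c
  exp-fixes-multiple {n} (periods∣n , _) c =
    let m , m-period = period-exists c
        i , fixed = period-fixes-multiple m-period
        divides q n≡q*m = periods∣n c m m-period
    in i , subst (λ k → (γ c ^ k) (mul S (suc i) c) ≡ mul S (suc i) c) (sym n≡q*m) (^-*-fixes (γ c) m fixed q)

  ⟨_⟩ : El S → U.Pred (El S) 0ℓ
  ⟨ y ⟩ x = _∈⟨_⟩ S x y

  ∈⟨⟩-trans : ∀ {x y z} → x ∈ ⟨ y ⟩ → y ∈ ⟨ z ⟩ → x ∈ ⟨ z ⟩
  ∈⟨⟩-trans (inj₁ refl)        y∈⟨z⟩             = y∈⟨z⟩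
  ∈⟨⟩-trans (inj₂ (s , x≡y⊕s)) (inj₁ refl)       = inj₂ (s , x≡y⊕s)
  ∈⟨⟩-trans (inj₂ (s , x≡y⊕s)) (inj₂ (t , refl)) = inj₂ (t ⊕ s , trans x≡y⊕s (assoc _ t s))

  ⊕-∈⟨⟩ : ∀ y s → y ⊕ s ∈ ⟨ y ⟩
  ⊕-∈⟨⟩ y s = inj₂ (s , refl)

  ⊕-mono-∈⟨⟩ : ∀ c {x y} → x ∈ ⟨ y ⟩ → c ⊕ x ∈ ⟨ c ⊕ y ⟩
  ⊕-mono-∈⟨⟩ c (inj₁ refl)       = inj₁ refl
  ⊕-mono-∈⟨⟩ c (inj₂ (s , refl)) = inj₂ (s , sym (assoc c _ s))

  ∈⟨⊕⟩⇒∈⟨mul⊕⟩ : ∀ {c x} → x ∈ ⟨ c ⊕ x ⟩ → ∀ j → x ∈ ⟨ mul S (suc j) c ⊕ x ⟩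
  ∈⟨⊕⟩⇒∈⟨mul⊕⟩         x∈⟨c⊕x⟩ zero    = x∈⟨c⊕x⟩
  ∈⟨⊕⟩⇒∈⟨mul⊕⟩ {c} {x} x∈⟨c⊕x⟩ (suc j) = ∈⟨⟩-trans x∈⟨c⊕x⟩
    (subst (λ z → c ⊕ x ∈ ⟨ z ⟩) (sym (assoc c _ x)) (⊕-mono-∈⟨⟩ c (∈⟨⊕⟩⇒∈⟨mul⊕⟩ x∈⟨c⊕x⟩ j)))

  γ^-fixes-ideal : ∀ c j {x y} → (γ c ^ j) y ≡ y → x ∈ ⟨ y ⟩ → (γ c ^ j) x ≡ x
  γ^-fixes-ideal c j         fixed (inj₁ refl)       = fixed
  γ^-fixes-ideal c j {y = y} fixed (inj₂ (s , refl)) = trans (γ^-⊕ c j y s) (cong (_⊕ s) fixed)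

  H : El S → U.Pred (El S) 0ℓ
  H a x = _∈H_ S x a

  St : El S → U.Pred (El S) 0ℓ
  St a c = _∈St_ S c a

  FixesH : El S → ℕ → Set
  FixesH a N = ∀ c → c ∈ St a → ∀ x → x ∈ H a → (γ c ^ N) x ≡ x

  H⇒∈⟨⟩ : ∀ {a x y} → x ∈ H a → y ∈ H a → x ∈ ⟨ y ⟩
  H⇒∈⟨⟩ {x = x} x∈Ha y∈Ha = proj₁ (y∈Ha x) (proj₂ (x∈Ha x) (inj₁ refl))

  -- x generates the same ideal as c ⊕ x, hence lies in the ideal of every multiple of c,
  -- in particular of one that γ c ^ n fixes.
  exp-fixesH : ∀ {n} → IsExp S n → ∀ a → FixesH a n
  exp-fixesH {n} expS a c c∈St x x∈Ha =
    let i , fixed = exp-fixes-multiple expS c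
    in γ^-fixes-ideal c n fixed (∈⟨⟩-trans (∈⟨⊕⟩⇒∈⟨mul⊕⟩ (H⇒∈⟨⟩ x∈Ha (c∈St x x∈Ha)) i) (⊕-∈⟨⟩ _ x))

  St-⊕ : ∀ {a c d} → c ∈ St a → d ∈ St a → c ⊕ d ∈ St a
  St-⊕ {a} {c} {d} c∈St d∈St x x∈Ha = subst (_∈ H a) (sym (assoc c d x)) (c∈St _ (d∈St x x∈Ha))

  St-mul : ∀ {a c} → c ∈ St a → ∀ j → mul S (suc j) c ∈ St a
  St-mul c∈St zero    = c∈St
  St-mul c∈St (suc j) = St-⊕ c∈St (St-mul c∈St j)

  γ^-H : ∀ {a c} → c ∈ St a → ∀ j {x} → x ∈ H a → (γ c ^ j) x ∈ H a
  γ^-H c∈St zero    x∈Ha = x∈Ha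
  γ^-H c∈St (suc j) x∈Ha = c∈St _ (γ^-H c∈St j x∈Ha)

  fixesH-∸ : ∀ {a i j} → i ≤ j → FixesH a i → FixesH a j → FixesH a (j ∸ i)
  fixesH-∸ {i = i} {j} i≤j fixᵢ fixⱼ c c∈St x x∈Ha = begin
    (γ c ^ (j ∸ i)) x              ≡⟨ cong (γ c ^ (j ∸ i)) (sym (fixᵢ c c∈St x x∈Ha)) ⟩
    (γ c ^ (j ∸ i)) ((γ c ^ i) x)  ≡⟨ sym (^-+ (γ c) (j ∸ i) i x) ⟩
    (γ c ^ (j ∸ i + i)) x          ≡⟨ cong (λ k → (γ c ^ k) x) (ℕₚ.m∸n+n≡m i≤j) ⟩
    (γ c ^ j) x                    ≡⟨ fixⱼ c c∈St x x∈Ha ⟩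
    x                              ∎
    where open ≡-Reasoning

  _∈⟨_⟩? : ∀ x y → Dec (x ∈ ⟨ y ⟩)
  x ∈⟨ y ⟩? = (x ≟ᶠ y) ⊎-dec any? (λ s → x ≟ᶠ y ⊕ s)

  H? : ∀ a x → Dec (x ∈ H a)
  H? a x = all? λ z → (z ∈⟨ a ⟩? →-dec z ∈⟨ x ⟩?) ×-dec (z ∈⟨ x ⟩? →-dec z ∈⟨ a ⟩?)

  St? : ∀ a c → Dec (c ∈ St a)
  St? a c = all? λ x → H? a x →-dec H? a (c ⊕ x)

  FixesH? : ∀ a N → Dec (FixesH a N)
  FixesH? a N = all? λ c → St? a c →-dec all? λ x → H? a x →-dec ((γ c ^ N) x ≟ᶠ x)

  fixesH⇒powNeutral : ∀ {a j} → FixesH a (suc j) → ∀ c → c ∈ St a → PowNeutral S a (suc j) c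
  fixesH⇒powNeutral {j = j} fix c c∈St = St-mul c∈St j , λ d d∈St x x∈Ha → begin
    (mul S (suc j) c ⊕ d) ⊕ x  ≡⟨ assoc _ d x ⟩
    mul S (suc j) c ⊕ (d ⊕ x)  ≡⟨ mul-⊕≡γ^ c j (d ⊕ x) ⟩
    (γ c ^ suc j) (d ⊕ x)      ≡⟨ fix c c∈St (d ⊕ x) (d∈St x x∈Ha) ⟩
    d ⊕ x                      ∎
    where open ≡-Reasoning

  -- Since γ c ^ suc n fixes x, x = c ⊕ y with y ∈ H a, and the neutral element fixes c ⊕ y.
  powNeutral⇒fixesH : ∀ {a n j} → FixesH a (suc n) →
                      (∀ c → c ∈ St a → PowNeutral S a (suc j) c) → FixesH a (suc j)
  powNeutral⇒fixesH {n = n} {j} fixₙ neutral c c∈St x x∈Ha = begin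
    (γ c ^ suc j) x  ≡⟨ sym (mul-⊕≡γ^ c j x) ⟩
    u ⊕ x            ≡⟨ cong (u ⊕_) x≡c⊕y ⟩
    u ⊕ (c ⊕ y)      ≡⟨ sym (assoc u c y) ⟩
    (u ⊕ c) ⊕ y      ≡⟨ proj₂ (neutral c c∈St) c c∈St y (γ^-H c∈St n x∈Ha) ⟩
    c ⊕ y            ≡⟨ sym x≡c⊕y ⟩
    x                ∎
    where
    open ≡-Reasoning
    u y : El S
    u = mul S (suc j) c
    y = (γ c ^ n) x
    x≡c⊕y : x ≡ c ⊕ y
    x≡c⊕y = sym (fixₙ c c∈St x x∈Ha)

  Γ-exponent : ∀ {n} → IsExp S n → 1 ≤ n → ∀ a → ∃ λ N → IsExpΓ S a N × N ∣ n
  Γ-exponent {suc n} expS _ a =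
    let j , fixⱼ , none-below = least-witness (FixesH? a ∘ suc) {n} fixₙ
        no-smaller : ∀ N → 1 ≤ N → N < suc j → ¬ (∀ c → c ∈ St a → PowNeutral S a N c)
        no-smaller = λ { (suc i) _ (s≤s i<j) neutral →
                           none-below i<j (powNeutral⇒fixesH {n = n} {i} fixₙ neutral) }
    in suc j , (s≤s z≤n , fixesH⇒powNeutral {j = j} fixⱼ , no-smaller) ,
       least-positive-∣ (fixesH-∸ {a}) {suc j} (s≤s z≤n) fixⱼ
         (λ { {suc i} _ (s≤s i<j) → none-below i<j }) fixₙ
    where
    fixₙ : FixesH a (suc n)
    fixₙ = exp-fixesH expS a

module RootsOfUnity {c ℓ} (K : Field c ℓ) where
  open Field K hiding (zero)
  open import Algebra.Properties.Semiring.Exp semiring using (_^_; ^-congˡ; ^-assocʳ)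
  open import Algebra.Properties.Ring ring using (+-cancelˡ; x∙y⁻¹≈ε⇒x≈y; [y-z]x≈yx-zx)
  open import Algebra.Solver.Ring.NaturalCoefficients.Default commutativeSemiring
  open import Relation.Binary.Reasoning.Setoid setoid

  pow≡^ : ∀ x k → pow K x k ≡ x ^ k
  pow≡^ x zero    = ≡.refl
  pow≡^ x (suc k) = ≡.cong (x *_) (pow≡^ x k)

  1#^≈1# : ∀ k → 1# ^ k ≈ 1#
  1#^≈1# zero    = refl
  1#^≈1# (suc k) = trans (*-identityˡ _) (1#^≈1# k)

  x≉0∧xy≈0⇒y≈0 : ∀ {x y} → x ≉ 0# → x * y ≈ 0# → y ≈ 0#
  x≉0∧xy≈0⇒y≈0 {x} {y} x≉0 xy≈0 with inverse x x≉0
  ... | x⁻¹ , xx⁻¹≈1 = begin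
    y              ≈⟨ sym (*-identityˡ y) ⟩
    1# * y         ≈⟨ *-congʳ (sym xx⁻¹≈1) ⟩
    (x * x⁻¹) * y  ≈⟨ solve 3 (λ x x⁻¹ y → (x :* x⁻¹) :* y := x⁻¹ :* (x :* y)) refl x x⁻¹ y ⟩
    x⁻¹ * (x * y)  ≈⟨ *-congˡ xy≈0 ⟩
    x⁻¹ * 0#       ≈⟨ zeroʳ x⁻¹ ⟩
    0#             ∎

  x≉y∧xz≈yz⇒z≈0 : ∀ {x y z} → x ≉ y → x * z ≈ y * z → z ≈ 0#
  x≉y∧xz≈yz⇒z≈0 {x} {y} {z} x≉y xz≈yz = x≉0∧xy≈0⇒y≈0 (λ x-y≈0 → x≉y (x∙y⁻¹≈ε⇒x≈y x y x-y≈0)) (begin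
    (x - y) * z    ≈⟨ [y-z]x≈yx-zx z x y ⟩
    x * z - y * z  ≈⟨ +-congʳ xz≈yz ⟩
    y * z - y * z  ≈⟨ -‿inverseʳ (y * z) ⟩
    0#             ∎)

  -- PolyFun d f: f is a polynomial function of degree ≤ d.  In the inductive step g is the
  -- divided difference of f at z, i.e. f x − f z = (x − z) g x, written without subtraction.
  data PolyFun : ℕ → (Carrier → Carrier) → Set (c ⊔ ℓ) where
    constant : ∀ {f} → (∀ x y → f x ≈ f y) → PolyFun 0 f
    divided  : ∀ {d f} → (∀ z → ∃ λ g → PolyFun d g × (∀ x → f x + z * g x ≈ f z + x * g x)) →
               PolyFun (suc d) f

  polyFun-weaken : ∀ {d f} → PolyFun d f → PolyFun (suc d) f
  polyFun-weaken (constant f-const) = divided λ z →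
    (λ _ → 0#) , constant (λ _ _ → refl) , λ x → +-cong (f-const x z) (trans (zeroʳ z) (sym (zeroʳ x)))
  polyFun-weaken (divided Δf) = divided λ z →
    let g , g-poly , g-spec = Δf z in g , polyFun-weaken g-poly , g-spec

  polyFun-+* : ∀ {d f h} k → PolyFun d f → PolyFun d h → PolyFun d (λ x → f x + k * h x)
  polyFun-+* k (constant f-const) (constant h-const) =
    constant λ x y → +-cong (f-const x y) (*-congˡ (h-const x y))
  polyFun-+* {f = f} {h} k (divided Δf) (divided Δh) = divided λ z →
    let g₁ , g₁-poly , g₁-spec = Δf z
        g₂ , g₂-poly , g₂-spec = Δh z
    in (λ x → g₁ x + k * g₂ x) , polyFun-+* k g₁-poly g₂-poly , λ x → begin
      (f x + k * h x) + z * (g₁ x + k * g₂ x)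
        ≈⟨ solve 6 (λ F k H z G₁ G₂ → (F :+ k :* H) :+ z :* (G₁ :+ k :* G₂)
                                   := (F :+ z :* G₁) :+ k :* (H :+ z :* G₂)) refl (f x) k (h x) z (g₁ x) (g₂ x) ⟩
      (f x + z * g₁ x) + k * (h x + z * g₂ x)
        ≈⟨ +-cong (g₁-spec x) (*-congˡ (g₂-spec x)) ⟩
      (f z + x * g₁ x) + k * (h z + x * g₂ x)
        ≈⟨ solve 6 (λ F k H x G₁ G₂ → (F :+ x :* G₁) :+ k :* (H :+ x :* G₂)
                                   := (F :+ k :* H) :+ x :* (G₁ :+ k :* G₂)) refl (f z) k (h z) x (g₁ x) (g₂ x) ⟩
      (f z + k * h z) + x * (g₁ x + k * g₂ x) ∎

  polyFun-^ : ∀ d → PolyFun d (_^ d)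
  polyFun-^ zero          = constant λ _ _ → refl
  polyFun-^ (suc zero)    = divided λ z → (λ _ → 1#) , constant (λ _ _ → refl) , λ x → +-comm _ _
  polyFun-^ (suc (suc d)) with polyFun-^ (suc d)
  ... | x^d⁺@(divided Δ) = divided λ z →
    let g , g-poly , g-spec = Δ z
    in (λ x → x ^ suc d + z * g x) , polyFun-+* z x^d⁺ (polyFun-weaken g-poly) , λ x → begin
      x * x ^ suc d + z * (x ^ suc d + z * g x)  ≈⟨ +-congˡ (*-congˡ (g-spec x)) ⟩
      x * x ^ suc d + z * (z ^ suc d + x * g x)
        ≈⟨ solve 5 (λ x z X Z G → x :* X :+ z :* (Z :+ x :* G) := z :* Z :+ x :* (X :+ z :* G))
                   refl x z (x ^ suc d) (z ^ suc d) (g x) ⟩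
      z * z ^ suc d + x * (x ^ suc d + z * g x)  ∎

  polyFun-constant : ∀ {d f v zs} → PolyFun d f → d < length zs → AllPairs _≉_ zs →
                     All (λ z → f z ≈ v) zs → ∀ x → f x ≈ v
  polyFun-constant {zs = z ∷ _} (constant f-const) _ _ (fz≈v ∷ _) x = trans (f-const x z) fz≈v
  polyFun-constant {suc d} {f} {v} {z ∷ zs} (divided Δf) (s≤s d<) (z≉ ∷ distinct) (fz≈v ∷ fzs≈v) x =
    begin
      f x            ≈⟨ sym (+-identityʳ _) ⟩
      f x + 0#       ≈⟨ +-congˡ (sym (y*gx≈0 z)) ⟩
      f x + z * g x  ≈⟨ g-spec x ⟩
      f z + x * g x  ≈⟨ +-congˡ (y*gx≈0 x) ⟩
      f z + 0#       ≈⟨ +-identityʳ _ ⟩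
      f z            ≈⟨ fz≈v ⟩
      v              ∎
    where
    g : Carrier → Carrier
    g = proj₁ (Δf z)
    g-poly : PolyFun d g
    g-poly = proj₁ (proj₂ (Δf z))
    g-spec : ∀ y → f y + z * g y ≈ f z + y * g y
    g-spec = proj₂ (proj₂ (Δf z))
    g-vanishes : ∀ {w} → z ≉ w → f w ≈ v → g w ≈ 0#
    g-vanishes {w} z≉w fw≈v = x≉y∧xz≈yz⇒z≈0 z≉w
      (+-cancelˡ (f z) _ _ (trans (+-congʳ (trans fz≈v (sym fw≈v))) (g-spec w)))
    g≈0 : ∀ y → g y ≈ 0#
    g≈0 = polyFun-constant g-poly d< distinct
            (All.zipWith (λ (z≉w , fw≈v) → g-vanishes z≉w fw≈v) (z≉ , fzs≈v))
    y*gx≈0 : ∀ y → y * g x ≈ 0#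
    y*gx≈0 y = trans (*-congˡ (g≈0 x)) (zeroʳ y)

  ^-solutions-length≤ : ∀ {d v zs} → 1 ≤ d → v ≉ 0# → AllPairs _≉_ zs →
                        All (λ z → z ^ d ≈ v) zs → length zs ≤ d
  ^-solutions-length≤ {suc d} {v} {zs} _ v≉0 distinct solutions with length zs ≤? suc d
  ... | yes ≤d = ≤d
  ... | no  ≰d = ⊥-elim (v≉0 (trans (sym 0^d≈v) (zeroˡ _)))
    where
    0^d≈v : 0# ^ suc d ≈ v
    0^d≈v = polyFun-constant (polyFun-^ (suc d)) (≰⇒> ≰d) distinct solutions 0#

  pow⇒^ : ∀ ζ k {v} → pow K ζ k ≈ v → ζ ^ k ≈ v
  pow⇒^ ζ k = ≡.subst (_≈ _) (pow≡^ ζ k)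

  ^⇒pow : ∀ ζ k {v} → ζ ^ k ≈ v → pow K ζ k ≈ v
  ^⇒pow ζ k = ≡.subst (_≈ _) (≡.sym (pow≡^ ζ k))

  -- n-th roots of unity as a type: given a complete list of distinct ones, their equality
  -- is decidable (compare positions), which lets us filter and count them.
  μ : ℕ → Set (c ⊔ ℓ)
  μ n = Σ Carrier (λ ζ → ζ ^ n ≈ 1#)

  ^-*-≈1# : ∀ {N ζ} k → ζ ^ N ≈ 1# → ζ ^ (k ℕ.* N) ≈ 1#
  ^-*-≈1# {N} {ζ} k ζ^N≈1 = begin
    ζ ^ (k ℕ.* N) ≡⟨ ≡.cong (ζ ^_) (ℕₚ.*-comm k N) ⟩
    ζ ^ (N ℕ.* k) ≈⟨ sym (^-assocʳ ζ N k) ⟩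
    (ζ ^ N) ^ k   ≈⟨ ^-congˡ k ζ^N≈1 ⟩
    1# ^ k        ≈⟨ 1#^≈1# k ⟩
    1#            ∎

  ^-root : ∀ {n ζ} k → ζ ^ n ≈ 1# → (ζ ^ k) ^ n ≈ 1#
  ^-root {n} {ζ} k ζ^n≈1 = trans (^-assocʳ ζ k n) (^-*-≈1# {n} k ζ^n≈1)

  root≉0 : ∀ {N ζ} → 1 ≤ N → ζ ^ N ≈ 1# → ζ ≉ 0#
  root≉0 {suc N} _ ζ^N≈1 ζ≈0 = 1≉0 (trans (sym ζ^N≈1) (trans (*-congʳ ζ≈0) (zeroˡ _)))

  module Divisor {n} (zs : List Carrier) (length≡n : length zs ≡ n)
                 (roots : All (λ ζ → ζ ^ n ≈ 1#) zs) (distinct : AllPairs _≉_ zs)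
                 (complete : ∀ ζ → ζ ^ n ≈ 1# → Any (ζ ≈_) zs) where

    rs : List (μ n)
    rs = All.toList roots

    proj₁-rs : map proj₁ rs ≡ zs
    proj₁-rs = go roots
      where
      go : ∀ {xs} (ps : All (λ ζ → ζ ^ n ≈ 1#) xs) → map proj₁ (All.toList ps) ≡ xs
      go []       = ≡.refl
      go (_ ∷ ps) = ≡.cong (_ ∷_) (go ps)

    rs-distinct : AllPairs (λ ζ ξ → proj₁ ζ ≉ proj₁ ξ) rs
    rs-distinct = AllPairs.map⁻ (≡.subst (AllPairs _≉_) (≡.sym proj₁-rs) distinct)

    rs-complete : ∀ {ζ} → ζ ^ n ≈ 1# → Any (λ ξ → ζ ≈ proj₁ ξ) rs
    rs-complete ζ^n≈1 = Any.map⁻ (≡.subst (Any _) (≡.sym proj₁-rs) (complete _ ζ^n≈1))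

    _≟μ_ : (ζ ξ : μ n) → Dec (proj₁ ζ ≈ proj₁ ξ)
    (ζ , ζ-root) ≟μ (ξ , ξ-root) =
      ≈-dec-within-distinct setoid distinct (complete ζ ζ-root) (complete ξ ξ-root)

    module _ (t N : ℕ) .{{_ : NonZero t}} .{{_ : NonZero N}} (n≡t*N : n ≡ t ℕ.* N) where

      IsRootᴺ? : (ζ : μ n) → Dec (proj₁ ζ ^ N ≈ 1#)
      IsRootᴺ? (ζ , ζ-root) = (ζ ^ N , ^-root {n} N ζ-root) ≟μ (1# , 1#^≈1# n)

      F : List (μ n)
      F = filter IsRootᴺ? rs

      rootᴺ⇒rootⁿ : ∀ {ξ} → ξ ^ N ≈ 1# → ξ ^ n ≈ 1#
      rootᴺ⇒rootⁿ {ξ} ξ^N≈1 = ≡.subst (λ k → ξ ^ k ≈ 1#) (≡.sym n≡t*N) (^-*-≈1# t ξ^N≈1)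

      F-complete : ∀ {ξ} → ξ ^ N ≈ 1# → Any (λ ζ → ξ ≈ proj₁ ζ) F
      F-complete {ξ} ξ^N≈1 with ξ∈rs ← rs-complete (rootᴺ⇒rootⁿ ξ^N≈1) | Any.filter⁺ IsRootᴺ? ξ∈rs
      ... | inj₁ ξ∈F   = ξ∈F
      ... | inj₂ ¬root = ⊥-elim (¬root (trans (^-congˡ N (sym (Any.lookup-result ξ∈rs))) ξ^N≈1))

      F-roots : All (λ ξ → ξ ^ N ≈ 1#) (map proj₁ F)
      F-roots = All.map⁺ (All.all-filter IsRootᴺ? rs)

      F-distinct : AllPairs _≉_ (map proj₁ F)
      F-distinct = AllPairs.map⁺ (AllPairs.filter⁺ IsRootᴺ? rs-distinct)

      length-F≤N : length F ≤ N
      length-F≤N = ≡.subst (_≤ N) (length-map proj₁ F)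
        (^-solutions-length≤ (ℕ.>-nonZero⁻¹ N) 1≉0 F-distinct F-roots)

      _^t≈_ : μ n → μ n → Set ℓ
      ζ ^t≈ ξ = proj₁ ζ ^ t ≈ proj₁ ξ

      _^t≈?_ : ∀ ζ ξ → Dec (ζ ^t≈ ξ)
      (ζ , ζ-root) ^t≈? ξ = (ζ ^ t , ^-root {n} t ζ-root) ≟μ ξ

      ^t-fibre-length≤ : ∀ {ξ} → proj₁ ξ ^ N ≈ 1# →
                         ∀ {ys} → AllPairs (λ ζ ζ′ → proj₁ ζ ≉ proj₁ ζ′) ys →
                         All (_^t≈ ξ) ys → length ys ≤ t
      ^t-fibre-length≤ {ξ} ξ-root {ys} ys-distinct ys-fibre = ≡.subst (_≤ t) (length-map proj₁ ys)
        (^-solutions-length≤ (ℕ.>-nonZero⁻¹ t) (root≉0 (ℕ.>-nonZero⁻¹ N) ξ-root)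
          (AllPairs.map⁺ ys-distinct) (All.map⁺ ys-fibre))

      ^t-lands-in-F : ∀ ζ → Any (ζ ^t≈_) F
      ^t-lands-in-F (ζ , ζ-root) = F-complete (trans (^-assocʳ ζ t N)
        (≡.subst (λ k → ζ ^ k ≈ 1#) n≡t*N ζ-root))

      length-rs : length rs ≡ N ℕ.* t
      length-rs = ≡.trans (≡.sym (length-map proj₁ rs)) (≡.trans (≡.cong length proj₁-rs)
                    (≡.trans length≡n (≡.trans n≡t*N (ℕₚ.*-comm t N))))

      N≤length-F : N ≤ length F
      N≤length-F = *-cancelʳ-≤ N (length F) t (≡.subst (_≤ length F ℕ.* t) length-rs
        (length≤length*fibre _^t≈?_ t F rs-distinct (All.universal ^t-lands-in-F rs)
          (All.map (λ {ξ} → ^t-fibre-length≤ {ξ}) (All.all-filter IsRootᴺ? rs))))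

      splittingᴺ : IsSplittingFieldFor K N
      splittingᴺ = map proj₁ F , ≡.trans (length-map proj₁ F) (≤-antisym length-F≤N N≤length-F) ,
                   All.map (^⇒pow _ N) F-roots , F-distinct ,
                   λ ξ ξ^N≈1 → Any.map⁺ (F-complete (pow⇒^ ξ N ξ^N≈1))

  splitting⇒1≤ : ∀ {n} → IsSplittingFieldFor K n → 1 ≤ n
  splitting⇒1≤ {n} (_ , ≡.refl , _ , _ , complete) with complete 1# (^⇒pow 1# n (1#^≈1# n))
  ... | here _  = s≤s z≤n
  ... | there _ = s≤s z≤n

  splitting-∣ : ∀ {n N} → N ∣ n → IsSplittingFieldFor K n → IsSplittingFieldFor K N
  splitting-∣ {n} {N} (divides t n≡t*N) split@(zs , length≡n , roots , distinct , complete) =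
    Divisor.splittingᴺ zs length≡n (All.map (pow⇒^ _ n) roots) distinct
      (λ ζ → complete ζ ∘ ^⇒pow ζ n) t N n≡t*N
    where
    instance
      t*N≢0 : NonZero (t ℕ.* N)
      t*N≢0 = ≡.subst NonZero n≡t*N (ℕ.>-nonZero (splitting⇒1≤ split))
      t≢0 : NonZero t
      t≢0 = m*n≢0⇒m≢0 t
      N≢0 : NonZero N
      N≢0 = m*n≢0⇒n≢0 t

lemma3p14 : {c ℓ : Level} (S : FinCommSemigroup) (n : ℕ) (K : Field c ℓ)
    → IsExp S n
    → IsSplittingFieldFor K n
    → (a : El S)
    → ∃ (λ s → _∈St_ S s a)
    → ∃ λ N → IsExpΓ S a N × N ∣ n × IsSplittingFieldFor K N
lemma3p14 S n K expS splits a _ =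
  let N , expΓ , N∣n = Translations.Γ-exponent S expS (RootsOfUnity.splitting⇒1≤ K splits) a
  in N , expΓ , N∣n , RootsOfUnity.splitting-∣ K N∣n splits
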